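{- Let $C=(\mathcal P(X),(g_\Diamond)_{\Diamond\in\mathrm{Al}})$ be a modal algebra, $\mathrm{Al}$ finite. (1) For a finite set $\mathcal Q\subseteq\mathcal P(X)$, the subalgebra of $C$ generated by $\mathcal Q$ is finite if and only if there exists a finite partition $\mathcal U$ of $X$ that refines $X/{\equiv_{\mathcal Q}}$ and is tuned in $C$. (2) $C$ is locally finite if and only if $C$ is tunable.
   Context: Here each $g_\Diamond:\mathcal P(X)\to\mathcal P(X)$ satisfies $g_\Diamond(\emptyset)=\emptyset$ and $g_\Diamond(U\cup V)=g_\Diamond(U)\cup g_\Diamond(V)$. For $\mathcal Q\subseteq\mathcal P(X)$, $a\equiv_{\mathcal Q}b$ iff $\forall P\in\mathcal Q(a\in P\Leftrightarrow b\in P)$. A partition $\mathcal U$ of $X$ is $g$-tuned if for all $U,V\in\mathcal U$, $V\cap g(U)\neq\emptyset$ implies $V\subseteq g(U)$; it is tuned in $C$ if it is $g_\Diamond$-tuned for each $\Diamond\in\mathrm{Al}$. $C$ is tunable if every finite partition of $X$ has a finite refinement tuned in $C$. An algebra is locally finite if each of its finitely generated subalgebras is finite. -}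

module Defs where

open import Level using (Level; Lift; suc; _⊔_)
open import Data.Nat using (ℕ)
open import Data.Fin using (Fin)
open import Data.List using (List)
open import Data.List.Membership.Propositional using (_∈_)
open import Data.List.Relation.Unary.Any using (Any)
open import Data.Product using (Σ; ∃; _×_; _,_)
open import Data.Empty using (⊥)
open import Relation.Unary using (Pred; _⊆_; _∪_; _∩_; ∁; _≐_; Satisfiable)
open import Relation.Binary.PropositionalEquality using (_≢_)
open import Function.Bundles using (_⇔_)

module _ {ℓ : Level} {X : Set ℓ} where

  ∅ℓ : Pred X ℓ
  ∅ℓ = λ _ → Lift ℓ ⊥

-- Subsets of X are predicates; set equality is extensional equality _≐_,
-- so each g_◇ is required to respect _≐_ (automatic for set-theoretic maps).
record ModalAlgebra {ℓ : Level} (X : Set ℓ) (k : ℕ) : Set (suc ℓ) where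
  field
    g    : Fin k → Pred X ℓ → Pred X ℓ
    g-cong : ∀ d {U V : Pred X ℓ} → U ≐ V → g d U ≐ g d V
    g-∅  : ∀ d → g d ∅ℓ ≐ ∅ℓ
    g-∪  : ∀ d (U V : Pred X ℓ) → g d (U ∪ V) ≐ (g d U ∪ g d V)

open ModalAlgebra public

module _ {ℓ : Level} {X : Set ℓ} {k : ℕ} (C : ModalAlgebra X k) where

  data Gen (Q : List (Pred X ℓ)) : Pred X ℓ → Set (suc ℓ) where
    gen : ∀ {P} → P ∈ Q → Gen Q P
    emp : Gen Q ∅ℓ
    cmp : ∀ {P} → Gen Q P → Gen Q (∁ P)
    uni : ∀ {P R} → Gen Q P → Gen Q R → Gen Q (P ∪ R)
    dia : ∀ d {P} → Gen Q P → Gen Q (g C d P)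
    ext : ∀ {P R} → P ≐ R → Gen Q P → Gen Q R

module _ {ℓ : Level} {X : Set ℓ} where

  FiniteFamily : Pred (Pred X ℓ) (suc ℓ) → Set (suc ℓ)
  FiniteFamily S = ∃ λ (L : List (Pred X ℓ)) → ∀ P → S P → Any (P ≐_) L

  _≡[_]_ : X → List (Pred X ℓ) → X → Set (suc ℓ)
  a ≡[ Q ] b = ∀ P → P ∈ Q → (P a ⇔ P b)

  record Partition (n : ℕ) : Set (suc ℓ) where
    field
      block    : Fin n → Pred X ℓ
      nonempty : ∀ i → Satisfiable (block i)
      disjoint : ∀ i j → i ≢ j → ∀ x → block i x → block j x → ⊥
      cover    : ∀ x → ∃ λ i → block i x

  open Partition public

  FinPartition : Set (suc ℓ)
  FinPartition = Σ ℕ Partition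

  Refines : FinPartition → FinPartition → Set ℓ
  Refines (_ , U) (_ , V) = ∀ i → ∃ λ j → block U i ⊆ block V j

  RefinesEquiv : FinPartition → List (Pred X ℓ) → Set (suc ℓ)
  RefinesEquiv (_ , U) Q = ∀ i a b → block U i a → block U i b → a ≡[ Q ] b

  IsTuned : (Pred X ℓ → Pred X ℓ) → FinPartition → Set ℓ
  IsTuned h (_ , U) = ∀ i j → Satisfiable (block U j ∩ h (block U i)) → block U j ⊆ h (block U i)

module _ {ℓ : Level} {X : Set ℓ} {k : ℕ} (C : ModalAlgebra X k) where

  TunedIn : FinPartition {X = X} → Set ℓ
  TunedIn 𝒰 = ∀ d → IsTuned (g C d) 𝒰

  Tunable : Set (suc ℓ)
  Tunable = ∀ (𝒱 : FinPartition {X = X}) → ∃ λ (𝒰 : FinPartition) → Refines 𝒰 𝒱 × TunedIn 𝒰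

  LocallyFinite : Set (suc ℓ)
  LocallyFinite = ∀ (Q : List (Pred X ℓ)) → FiniteFamily (Gen C Q)

{-# OPTIONS --safe #-}
-- A set generated from Q is a union of blocks (saturated) for every partition that refines ≡_Q and is
-- tuned: the saturated sets contain Q, are closed under the Boolean operations, and are closed under each
-- g◇ because g◇ is finitely additive and g◇ of a block is itself saturated. A partition into n blocks has
-- at most 2ⁿ saturated sets. Conversely, if the generated subalgebra is finite, its atoms (the nonempty
-- intersections of members and complements of members) partition X and refine ≡_Q; the partition is tuned
-- because g◇ of an atom is again a member, hence a union of atoms. For (2), apply (1) to the blocks of a
-- given partition, and to the atoms of Q.
module Submission where

open import Defs
open import Level using (Level; lower)
open import Data.Nat using (ℕ; zero; suc)
open import Data.Fin using (Fin; zero; suc)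
open import Data.Bool using (true; false)
open import Data.List using (List; []; _∷_; _++_; map; length; lookup; filter; tabulate; allFin)
open import Data.List.Relation.Unary.Any using (Any; here; there)
import Data.List.Relation.Unary.Any as Any
import Data.List.Relation.Unary.Any.Properties as Any
open import Data.List.Relation.Unary.All using (All; []; _∷_)
import Data.List.Relation.Unary.All as All
import Data.List.Relation.Unary.All.Properties as All
open import Data.List.Relation.Unary.AllPairs using (AllPairs; []; _∷_)
import Data.List.Relation.Unary.AllPairs as AllPairs
import Data.List.Relation.Unary.AllPairs.Properties as AllPairs
open import Data.List.Membership.Propositional using (_∈_; find; lose)
open import Data.List.Membership.Propositional.Properties
  using (∈-lookup; ∈-map⁺; ∈-++⁺ˡ; ∈-++⁺ʳ; ∈-filter⁺; ∈-filter⁻; ∈-allFin; ∈-tabulate⁺)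
open import Data.Empty using (⊥-elim)
open import Data.Sum using (inj₁; inj₂; [_,_]′)
open import Data.Product using (∃; _×_; _,_; proj₁; proj₂)
import Data.Product as Product
open import Function using (_∘_; id)
open import Function.Bundles using (_⇔_; mk⇔; Equivalence)
open import Relation.Binary.Definitions using (Symmetric)
open import Relation.Binary.Core using (Rel)
open import Relation.Binary.PropositionalEquality using (_≡_; refl; cong; subst; _≢_)
open import Relation.Nullary using (yes; no; does)
open import Relation.Nullary.Decidable using (decidable-stable)
open import Relation.Unary using (Pred; Decidable; Empty; Satisfiable; _⊆_; _∪_; _∩_; ∁; _≐_; ⋃; _⊥_)
open import Relation.Unary.Properties using (≐-refl; ≐-sym; ≐-trans; ⊥-sym)
open import Axiom.ExcludedMiddle using (ExcludedMiddle)

module _ {a r} {A : Set a} {R : Rel A r} where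

  AllPairs-lookup : Symmetric R → ∀ {xs} → AllPairs R xs →
                    {i j : Fin (length xs)} → i ≢ j → R (lookup xs i) (lookup xs j)
  AllPairs-lookup sym (_ ∷ _)    {zero}  {zero}  i≢j = ⊥-elim (i≢j refl)
  AllPairs-lookup sym (Rx ∷ _)   {zero}  {suc j} _   = All.lookup Rx (∈-lookup j)
  AllPairs-lookup sym (Rx ∷ _)   {suc i} {zero}  _   = sym (All.lookup Rx (∈-lookup i))
  AllPairs-lookup sym (_ ∷ Rxs)  {suc i} {suc j} i≢j = AllPairs-lookup sym Rxs (i≢j ∘ cong suc)

module _ {a} {A : Set a} where

  sublists : List A → List (List A)
  sublists []       = [] ∷ []
  sublists (x ∷ xs) = map (x ∷_) (sublists xs) ++ sublists xs

  filter-∈-sublists : ∀ {p} {P : Pred A p} (P? : Decidable P) xs → filter P? xs ∈ sublists xs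
  filter-∈-sublists P? []       = here refl
  filter-∈-sublists P? (x ∷ xs) with does (P? x)
  ... | true  = ∈-++⁺ˡ (∈-map⁺ (x ∷_) (filter-∈-sublists P? xs))
  ... | false = ∈-++⁺ʳ _ (filter-∈-sublists P? xs)

module _ {ℓ : Level} {X : Set ℓ} where

  ∁-cong : {A B : Pred X ℓ} → A ≐ B → ∁ A ≐ ∁ B
  ∁-cong (A⊆B , B⊆A) = (λ ¬a b → ¬a (B⊆A b)) , (λ ¬b a → ¬b (A⊆B a))

  ∪-cong : {A B A′ B′ : Pred X ℓ} → A ≐ B → A′ ≐ B′ → (A ∪ A′) ≐ (B ∪ B′)
  ∪-cong (A⊆B , B⊆A) (A′⊆B′ , B′⊆A′) =
    [ inj₁ ∘ A⊆B , inj₂ ∘ A′⊆B′ ]′ , [ inj₁ ∘ B⊆A , inj₂ ∘ B′⊆A′ ]′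

  Uncut : Pred X ℓ → Pred X ℓ → Set ℓ
  Uncut P A = Satisfiable (A ∩ P) → A ⊆ P

  uncut-⊆ : {P A B : Pred X ℓ} → B ⊆ A → Uncut P A → Uncut P B
  uncut-⊆ B⊆A uncut (x , x∈B , x∈P) y∈B = uncut (x , B⊆A x∈B , x∈P) (B⊆A y∈B)

  -- IsTuned h 𝒰 unfolds to ∀ i → Saturated 𝒰 (h (block i)).
  Saturated : FinPartition {X = X} → Pred X ℓ → Set ℓ
  Saturated (_ , 𝒰) P = ∀ i → Uncut P (block 𝒰 i)

  module _ (𝒰 : FinPartition {X = X}) where

    saturated-∅ : Saturated 𝒰 ∅ℓ
    saturated-∅ i (_ , _ , x∈∅) = ⊥-elim (lower x∈∅)

    saturated-∁ : {P : Pred X ℓ} → Saturated 𝒰 P → Saturated 𝒰 (∁ P)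
    saturated-∁ sat i (x , x∈B , x∉P) y∈B y∈P = x∉P (sat i (_ , y∈B , y∈P) x∈B)

    saturated-∪ : {P R : Pred X ℓ} → Saturated 𝒰 P → Saturated 𝒰 R → Saturated 𝒰 (P ∪ R)
    saturated-∪ satP satR i (x , x∈B , inj₁ x∈P) y∈B = inj₁ (satP i (x , x∈B , x∈P) y∈B)
    saturated-∪ satP satR i (x , x∈B , inj₂ x∈R) y∈B = inj₂ (satR i (x , x∈B , x∈R) y∈B)

    saturated-resp-≐ : {P R : Pred X ℓ} → P ≐ R → Saturated 𝒰 P → Saturated 𝒰 R
    saturated-resp-≐ (P⊆R , R⊆P) sat i (x , x∈B , x∈R) y∈B = P⊆R (sat i (x , x∈B , R⊆P x∈R) y∈B)

  module _ {Q : List (Pred X ℓ)} where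

    refinesEquiv⇒saturated : ∀ 𝒰 {P} → RefinesEquiv 𝒰 Q → P ∈ Q → Saturated 𝒰 P
    refinesEquiv⇒saturated 𝒰 re P∈Q i (x , x∈B , x∈P) {y} y∈B = Equivalence.to (re i x y x∈B y∈B _ P∈Q) x∈P

    saturated⇒refinesEquiv : ∀ 𝒰 → (∀ {P} → P ∈ Q → Saturated 𝒰 P) → RefinesEquiv 𝒰 Q
    saturated⇒refinesEquiv 𝒰 sat i a b a∈B b∈B P P∈Q =
      mk⇔ (λ a∈P → sat P∈Q i (a , a∈B , a∈P) b∈B) (λ b∈P → sat P∈Q i (b , b∈B , b∈P) a∈B)

    refines-refinesEquiv-trans : ∀ {𝒰 𝒱} → Refines 𝒰 𝒱 → RefinesEquiv 𝒱 Q → RefinesEquiv 𝒰 Q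
    refines-refinesEquiv-trans 𝒰≤𝒱 re i a b a∈U b∈U =
      let (j , U⊆V) = 𝒰≤𝒱 i in re j a b (U⊆V a∈U) (U⊆V b∈U)

  refinesEquiv-blocks⇒refines : ∀ 𝒰 {n} (𝒱 : Partition {X = X} n) →
                                RefinesEquiv 𝒰 (tabulate (block 𝒱)) → Refines 𝒰 (n , 𝒱)
  refinesEquiv-blocks⇒refines (_ , 𝒰) 𝒱 re i =
    let (x , x∈U) = nonempty 𝒰 i
        (j , x∈V) = cover 𝒱 x
    in j , λ {a} a∈U → Equivalence.from (re i a x a∈U x∈U _ (∈-tabulate⁺ j)) x∈V

  ⊆-⋃-blocks : ∀ {n} (𝒰 : Partition {X = X} n) (P : Pred X ℓ) → P ⊆ ⋃ (Fin n) (λ i → block 𝒰 i ∩ P)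
  ⊆-⋃-blocks 𝒰 P {x} x∈P = let (i , x∈B) = cover 𝒰 x in i , x∈B , x∈P

  atoms : List (Pred X ℓ) → List (Pred X ℓ)
  atoms []      = ∁ ∅ℓ ∷ []
  atoms (P ∷ M) = map (_∩ P) (atoms M) ++ map (_∩ ∁ P) (atoms M)

  atoms-disjoint : ∀ M → AllPairs _⊥_ (atoms M)
  atoms-disjoint []      = [] ∷ []
  atoms-disjoint (P ∷ M) = AllPairs.++⁺ (restrict (atoms-disjoint M)) (restrict (atoms-disjoint M)) inside⊥outside
    where
      restrict : ∀ {S} → AllPairs _⊥_ (atoms M) → AllPairs _⊥_ (map (_∩ S) (atoms M))
      restrict = AllPairs.map⁺ ∘ AllPairs.map (λ A⊥B {x} (x∈A , x∈B) → A⊥B (proj₁ x∈A , proj₁ x∈B))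
      inside⊥outside : All (λ A → All (A ⊥_) (map (_∩ ∁ P) (atoms M))) (map (_∩ P) (atoms M))
      inside⊥outside =
        All.map⁺ (All.universal (λ _ → All.map⁺ (All.universal (λ _ {_} ((_ , p) , (_ , ¬p)) → ¬p p) _)) _)

  atoms-uncut : ∀ {M P} → P ∈ M → All (Uncut P) (atoms M)
  atoms-uncut {P ∷ M} (here refl) =
    All.++⁺ (All.map⁺ {f = _∩ P} (All.universal (λ _ _ {_} → proj₂) (atoms M)))
            (All.map⁺ {f = _∩ ∁ P} (All.universal (λ { _ (_ , (_ , ¬p) , p) {_} → ⊥-elim (¬p p) }) (atoms M)))
  atoms-uncut {R ∷ M} (there P∈M) =
    All.++⁺ (All.map⁺ {f = _∩ R} (All.map (uncut-⊆ proj₁) (atoms-uncut P∈M)))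
            (All.map⁺ {f = _∩ ∁ R} (All.map (uncut-⊆ proj₁) (atoms-uncut P∈M)))

  atoms-closed : ∀ {p} (Φ : Pred (Pred X ℓ) p) → Φ (∁ ∅ℓ) → (∀ {A B} → Φ A → Φ B → Φ (A ∩ B)) →
                 (∀ {A} → Φ A → Φ (∁ A)) → ∀ {M} → All Φ M → All Φ (atoms M)
  atoms-closed Φ Φ-⊤ Φ-∩ Φ-∁ []        = Φ-⊤ ∷ []
  atoms-closed Φ Φ-⊤ Φ-∩ Φ-∁ {_ ∷ M} (ΦP ∷ ΦM) =
    All.++⁺ (All.map⁺ (All.map (λ ΦA → Φ-∩ ΦA ΦP) ΦatomsM)) (All.map⁺ (All.map (λ ΦA → Φ-∩ ΦA (Φ-∁ ΦP)) ΦatomsM))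
    where
      ΦatomsM : All Φ (atoms M)
      ΦatomsM = atoms-closed Φ Φ-⊤ Φ-∩ Φ-∁ ΦM

module _ {ℓ : Level} {X : Set ℓ} {k : ℕ} (C : ModalAlgebra X k) (d : Fin k) where

  g-mono : {A B : Pred X ℓ} → A ⊆ B → g C d A ⊆ g C d B
  g-mono {A} {B} A⊆B x∈gA = proj₁ (g-cong C d A∪B≐B) (proj₂ (g-∪ C d A B) (inj₁ x∈gA))
    where
      A∪B≐B : (A ∪ B) ≐ B
      A∪B≐B = [ A⊆B , id ]′ , inj₂

  g-Empty : {A : Pred X ℓ} → Empty A → Empty (g C d A)
  g-Empty empty x x∈gA = lower (proj₁ (g-∅ C d) (g-mono (λ {y} y∈A → ⊥-elim (empty y y∈A)) x∈gA))

  g-⋃ : ∀ {n} (F : Fin n → Pred X ℓ) → g C d (⋃ (Fin n) F) ⊆ ⋃ (Fin n) (λ i → g C d (F i))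
  g-⋃ {zero}  F {x} x∈g⋃ = ⊥-elim (g-Empty (λ { _ (() , _) }) x x∈g⋃)
  g-⋃ {suc n} F x∈g⋃ =
    [ (zero ,_) , Product.map suc id ∘ g-⋃ (F ∘ suc) ]′
      (proj₁ (g-∪ C d (F zero) (⋃ (Fin n) (F ∘ suc))) (g-mono split x∈g⋃))
    where
      split : ⋃ (Fin (suc n)) F ⊆ F zero ∪ ⋃ (Fin n) (F ∘ suc)
      split (zero  , x∈F) = inj₁ x∈F
      split (suc i , x∈F) = inj₂ (i , x∈F)

data Term (n k : ℕ) : Set where
  var  : Fin n → Term n k
  ∅ᵗ   : Term n k
  ∁ᵗ   : Term n k → Term n k
  _∪ᵗ_ : Term n k → Term n k → Term n k
  ◇ᵗ   : Fin k → Term n k → Term n k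

module _ {ℓ : Level} {X : Set ℓ} {k : ℕ} (C : ModalAlgebra X k) (Q : List (Pred X ℓ)) where

  ⟦_⟧ : Term (length Q) k → Pred X ℓ
  ⟦ var i ⟧   = lookup Q i
  ⟦ ∅ᵗ ⟧      = ∅ℓ
  ⟦ ∁ᵗ t ⟧    = ∁ ⟦ t ⟧
  ⟦ t ∪ᵗ u ⟧  = ⟦ t ⟧ ∪ ⟦ u ⟧
  ⟦ ◇ᵗ d t ⟧  = g C d ⟦ t ⟧

  -- Gen C Q lives in Set (suc ℓ), out of reach of ExcludedMiddle ℓ; definability by a term is an
  -- equivalent predicate in Set ℓ.
  Definable : Pred (Pred X ℓ) ℓ
  Definable P = ∃ λ t → P ≐ ⟦ t ⟧

  ⟦⟧-Gen : ∀ t → Gen C Q ⟦ t ⟧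
  ⟦⟧-Gen (var i)  = gen (∈-lookup i)
  ⟦⟧-Gen ∅ᵗ       = emp
  ⟦⟧-Gen (∁ᵗ t)   = cmp (⟦⟧-Gen t)
  ⟦⟧-Gen (t ∪ᵗ u) = uni (⟦⟧-Gen t) (⟦⟧-Gen u)
  ⟦⟧-Gen (◇ᵗ d t) = dia d (⟦⟧-Gen t)

  Gen⇒Definable : ∀ {P} → Gen C Q P → Definable P
  Gen⇒Definable {P} (gen P∈Q) = var (Any.index P∈Q) , subst (P ≐_) (Any.lookup-index P∈Q) ≐-refl
  Gen⇒Definable emp           = ∅ᵗ , ≐-refl
  Gen⇒Definable (cmp h)       = Product.map ∁ᵗ ∁-cong (Gen⇒Definable h)
  Gen⇒Definable (uni h h′)    =
    let (t , P≐t) = Gen⇒Definable h ; (u , R≐u) = Gen⇒Definable h′ in t ∪ᵗ u , ∪-cong P≐t R≐u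
  Gen⇒Definable (dia d h)     = Product.map (◇ᵗ d) (g-cong C d) (Gen⇒Definable h)
  Gen⇒Definable (ext P≐R h)   = Product.map id (≐-trans (≐-sym P≐R)) (Gen⇒Definable h)

module _ {ℓ : Level} (em : ExcludedMiddle ℓ) {X : Set ℓ} where

  module _ (Bs : List (Pred X ℓ)) (disjoint : AllPairs _⊥_ Bs) (covers : ∀ x → Any (λ B → B x) Bs) where

    private
      nonempty? : Decidable (Satisfiable {A = X} {ℓ = ℓ})
      nonempty? _ = em

      nonemptyBs : List (Pred X ℓ)
      nonemptyBs = filter nonempty? Bs

      covers⁺ : ∀ x → ∃ λ i → lookup nonemptyBs i x
      covers⁺ x with Any.filter⁺ nonempty? (covers x)
      ... | inj₁ x∈Bs⁺ = Any.index x∈Bs⁺ , Any.lookup-index x∈Bs⁺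
      ... | inj₂ empty = ⊥-elim (empty (x , Any.lookup-result (covers x)))

    listPartition : FinPartition {X = X}
    listPartition = length nonemptyBs , record
      { block    = lookup nonemptyBs
      ; nonempty = λ i → All.lookup (All.all-filter nonempty? Bs) (∈-lookup i)
      ; disjoint = λ i j i≢j x x∈Bi x∈Bj →
          AllPairs-lookup ⊥-sym (AllPairs.filter⁺ nonempty? disjoint) i≢j (x∈Bi , x∈Bj)
      ; cover    = covers⁺
      }

    listPartition-blocks : ∀ {p} {Φ : Pred (Pred X ℓ) p} → All Φ Bs → ∀ i → Φ (block (proj₂ listPartition) i)
    listPartition-blocks ΦBs i = All.lookup (All.filter⁺ nonempty? ΦBs) (∈-lookup i)

  atoms-cover : ∀ (M : List (Pred X ℓ)) x → Any (λ A → A x) (atoms M)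
  atoms-cover []      x = here lower
  atoms-cover (P ∷ M) x with em {P x}
  ... | yes x∈P = Any.++⁺ˡ (Any.map⁺ (Any.map (_, x∈P) (atoms-cover M x)))
  ... | no  x∉P = Any.++⁺ʳ _ (Any.map⁺ (Any.map (_, x∉P) (atoms-cover M x)))

  atomPartition : List (Pred X ℓ) → FinPartition {X = X}
  atomPartition M = listPartition (atoms M) (atoms-disjoint M) (atoms-cover M)

  atomPartition-saturated : ∀ {M : List (Pred X ℓ)} {P} → P ∈ M → Saturated (atomPartition M) P
  atomPartition-saturated {M} P∈M =
    listPartition-blocks (atoms M) (atoms-disjoint M) (atoms-cover M) (atoms-uncut P∈M)

  atomPartition-closed : ∀ {p} (Φ : Pred (Pred X ℓ) p) → Φ (∁ ∅ℓ) → (∀ {A B} → Φ A → Φ B → Φ (A ∩ B)) →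
                         (∀ {A} → Φ A → Φ (∁ A)) → ∀ {M} → All Φ M → ∀ i → Φ (block (proj₂ (atomPartition M)) i)
  atomPartition-closed Φ Φ-⊤ Φ-∩ Φ-∁ {M} ΦM =
    listPartition-blocks (atoms M) (atoms-disjoint M) (atoms-cover M) (atoms-closed Φ Φ-⊤ Φ-∩ Φ-∁ ΦM)

  atomPartition-refinesEquiv : ∀ (Q : List (Pred X ℓ)) → RefinesEquiv (atomPartition Q) Q
  atomPartition-refinesEquiv Q = saturated⇒refinesEquiv (atomPartition Q) atomPartition-saturated

  saturated-finite : ∀ (𝒰 : FinPartition {X = X}) → ∃ λ (L : List (Pred X ℓ)) → ∀ {P} → Saturated 𝒰 P → Any (P ≐_) L
  saturated-finite (n , 𝒰) = map unionOf (sublists (allFin n)) , λ {P} sat →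
      Any.map⁺ (lose (filter-∈-sublists (meets? P) (allFin n)) (saturated-≐-union sat))
    where
      unionOf : List (Fin n) → Pred X ℓ
      unionOf is x = Any (λ i → block 𝒰 i x) is

      meets? : ∀ P → Decidable (λ i → Satisfiable (block 𝒰 i ∩ P))
      meets? P i = em

      saturated-≐-union : ∀ {P} → Saturated (n , 𝒰) P → P ≐ unionOf (filter (meets? P) (allFin n))
      saturated-≐-union {P} sat =
          (λ {x} x∈P →
             let (i , x∈B) = cover 𝒰 x in
             lose (∈-filter⁺ (meets? P) (∈-allFin i) (x , x∈B , x∈P)) x∈B)
        , (λ x∈⋃ →
             let (i , i∈ , x∈B) = find x∈⋃ in
             sat i (proj₂ (∈-filter⁻ (meets? P) {xs = allFin n} i∈)) x∈B)

  module _ {k : ℕ} (C : ModalAlgebra X k) where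

    saturated-g : ∀ {n} (𝒰 : Partition n) {P} d →
                  IsTuned (g C d) (n , 𝒰) → Saturated (n , 𝒰) P → Saturated (n , 𝒰) (g C d P)
    saturated-g 𝒰 {P} d tuned sat j (x , x∈Bj , x∈gP)
      with g-⋃ C d (λ i → block 𝒰 i ∩ P) (g-mono C d (⊆-⋃-blocks 𝒰 P) x∈gP)
    ... | i , x∈g[Bi∩P] with em {Satisfiable (block 𝒰 i ∩ P)}
    ...   | yes Bi≬P = g-mono C d (sat i Bi≬P) ∘ tuned i j (x , x∈Bj , g-mono C d proj₁ x∈g[Bi∩P])
    ...   | no ¬Bi≬P = ⊥-elim (g-Empty C d (λ y → ¬Bi≬P ∘ (y ,_)) x x∈g[Bi∩P])

    module _ {Q : List (Pred X ℓ)} (𝒰 : FinPartition {X = X}) (re : RefinesEquiv 𝒰 Q) (tuned : TunedIn C 𝒰) where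

      Gen-saturated : ∀ {P} → Gen C Q P → Saturated 𝒰 P
      Gen-saturated (gen P∈Q)   = refinesEquiv⇒saturated 𝒰 re P∈Q
      Gen-saturated emp         = saturated-∅ 𝒰
      Gen-saturated (cmp h)     = saturated-∁ 𝒰 (Gen-saturated h)
      Gen-saturated (uni h h′)  = saturated-∪ 𝒰 (Gen-saturated h) (Gen-saturated h′)
      Gen-saturated (dia d h)   = saturated-g (proj₂ 𝒰) d (tuned d) (Gen-saturated h)
      Gen-saturated (ext P≐R h) = saturated-resp-≐ 𝒰 P≐R (Gen-saturated h)

      tuned⇒finite : FiniteFamily (Gen C Q)
      tuned⇒finite = let (L , complete) = saturated-finite 𝒰 in L , λ _ → complete ∘ Gen-saturated

    Gen-∩ : ∀ {Q A B} → Gen C Q A → Gen C Q B → Gen C Q (A ∩ B)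
    Gen-∩ {A = A} {B} A∈Gen B∈Gen = ext deMorgan (cmp (uni (cmp A∈Gen) (cmp B∈Gen)))
      where
        deMorgan : ∁ (∁ A ∪ ∁ B) ≐ (A ∩ B)
        deMorgan =
            (λ ¬[¬A∪¬B] → decidable-stable em (¬[¬A∪¬B] ∘ inj₁) , decidable-stable em (¬[¬A∪¬B] ∘ inj₂))
          , (λ (x∈A , x∈B) → [ (λ x∉A → x∉A x∈A) , (λ x∉B → x∉B x∈B) ]′)

    Gen-enumeration : ∀ {Q} → FiniteFamily (Gen C Q) →
                      ∃ λ (M : List (Pred X ℓ)) → All (Gen C Q) M × (∀ {P} → Gen C Q P → Any (P ≐_) M)
    Gen-enumeration {Q} (L , listed) =
        filter definable? L
      , All.map (λ (t , P≐t) → ext (≐-sym P≐t) (⟦⟧-Gen C Q t)) (All.all-filter definable? L)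
      , complete
      where
        definable? : Decidable (Definable C Q)
        definable? _ = em

        complete : ∀ {P} → Gen C Q P → Any (P ≐_) (filter definable? L)
        complete {P} P∈Gen with Any.filter⁺ definable? (listed P P∈Gen)
        ... | inj₁ found      = found
        ... | inj₂ ¬definable =
          ⊥-elim (¬definable (Product.map₂ (≐-trans (≐-sym (Any.lookup-result (listed P P∈Gen))))
                                           (Gen⇒Definable C Q P∈Gen)))

    finite⇒tuned : ∀ {Q} → FiniteFamily (Gen C Q) → ∃ λ 𝒰 → RefinesEquiv 𝒰 Q × TunedIn C 𝒰
    finite⇒tuned {Q} finite with Gen-enumeration finite
    ... | M , M⊆Gen , Gen⊆M =
        atomPartition M
      , saturated⇒refinesEquiv (atomPartition M) (saturated ∘ gen)
      , λ d i → saturated (dia d (block-Gen i))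
      where
        saturated : ∀ {P} → Gen C Q P → Saturated (atomPartition M) P
        saturated P∈Gen = let (R , R∈M , P≐R) = find (Gen⊆M P∈Gen) in
          saturated-resp-≐ (atomPartition M) (≐-sym P≐R) (atomPartition-saturated R∈M)

        block-Gen : ∀ i → Gen C Q (block (proj₂ (atomPartition M)) i)
        block-Gen = atomPartition-closed (Gen C Q) (cmp emp) Gen-∩ cmp M⊆Gen

    tunable⇒locallyFinite : Tunable C → LocallyFinite C
    tunable⇒locallyFinite tunable Q =
      let (𝒰 , 𝒰≤atoms , tuned) = tunable (atomPartition Q) in
      tuned⇒finite 𝒰
        (refines-refinesEquiv-trans {𝒰 = 𝒰} {atomPartition Q} 𝒰≤atoms (atomPartition-refinesEquiv Q)) tuned

    locallyFinite⇒tunable : LocallyFinite C → Tunable C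
    locallyFinite⇒tunable locallyFinite (n , 𝒱) =
      let (𝒰 , re , tuned) = finite⇒tuned (locallyFinite (tabulate (block 𝒱))) in
      𝒰 , refinesEquiv-blocks⇒refines 𝒰 𝒱 re , tuned

proposition4p2 : ∀ {ℓ : Level} → ExcludedMiddle ℓ → {X : Set ℓ} {k : ℕ} (C : ModalAlgebra X k)
    → (∀ (Q : List (Pred X ℓ)) → FiniteFamily (Gen C Q) ⇔ (∃ λ (𝒰 : FinPartition {X = X}) → RefinesEquiv 𝒰 Q × TunedIn C 𝒰))
      × (LocallyFinite C ⇔ Tunable C)
proposition4p2 em C =
    (λ Q → mk⇔ (finite⇒tuned em C) (λ (𝒰 , re , tuned) → tuned⇒finite em C 𝒰 re tuned))
  , mk⇔ (locallyFinite⇒tunable em C) (tunable⇒locallyFinite em C)
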